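{- Let $m,n$ be coprime positive integers and let $w$ be a finite word over $\{\mathbb{0},\mathbb{1},\mathbb{2}\}$ in which each of the three letters occurs. The following are equivalent: (1) $w=\phi(C(m,n)^p)$ for some integer $p\geqslant1$ with $pm$ even; (2) the graphical representation $\gamma(w)$ is a $3$-dimensional discrete approximation of the pair of slopes $(\tfrac{n}{m},\tfrac{n}{m})$, where steps are read as $\xi\mapsto\mathbb{0}$, $\eta\mapsto\mathbb{1}$, $\zeta\mapsto\mathbb{2}$.
   Context: The Christoffel word $C(m,n)$ (coprime positive $m,n$) is the binary word read off from the lattice path in $\mathbb{R}^2$ from $(0,0)$ to $(m,n)$ with unit steps $(1,0)\mapsto\mathbb{0}$, $(0,1)\mapsto\mathbb{1}$, where $(0,1)$ is taken whenever the resulting point is not strictly above the line $y=\frac{n}{m}x$ and $(1,0)$ otherwise. The map $\phi$ sends a binary word with an even number of $\mathbb{0}$'s to the ternary word obtained by replacing each $\mathbb{1}$ by $\mathbb{2}$ and each even-numbered occurrence of $\mathbb{0}$ (2nd, 4th, … from the left) by $\mathbb{1}$. Let $\xi=(1,0,0)$, $\eta=(0,1,0)$, $\zeta=(0,0,1)$. For a word $w$ over $\{\mathbb{0},\mathbb{1},\mathbb{2}\}$, its graphical representation $\gamma(w)$ is the lattice path in $\mathbb{R}^3$ starting at the origin and performing, for each letter of $w$ from left to right, the step $\xi$, $\eta$ or $\zeta$ for the letter $\mathbb{0}$, $\mathbb{1}$ or $\mathbb{2}$ respectively. For rational $q_1,q_2$, a $3$-dimensional discrete approximation of the pair $(q_1,q_2)$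 is a path constructed as follows: start at $(0,0,0)$; at each stage perform the step $\zeta$ whenever the resulting point does not lie strictly above the plane $z=q_1x+q_2y$; otherwise perform one of $\xi,\eta$, these being used alternately along the path with $\xi$ used first; the procedure may be terminated at any (non-initial) point $(x^*,y^*,z^*)$ with $x^*=y^*$ and $z^*=q_1x^*+q_2y^*$. -}

module Defs where

open import Data.Nat as ℕ using (ℕ; zero; suc; _+_; _*_)
import Data.Nat.Properties as ℕP
open import Data.Bool using (Bool; true; false; if_then_else_)
open import Data.List using (List; []; _∷_; concat; replicate)
open import Data.Product using (_×_; _,_)
open import Data.Unit using (⊤)
open import Data.Empty using (⊥)
open import Relation.Binary.PropositionalEquality using (_≡_)
open import Relation.Nullary using (does)
open import Data.Integer using (+_)
open import Data.Rational as ℚ using (ℚ)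
import Data.Rational.Properties as ℚP

data Bit : Set where
  b0 b1 : Bit

data Letter : Set where
  t0 t1 t2 : Letter

-- Christoffel word C(m,n)
-- Current lattice point (x , y); step (0,1) ↦ 𝟙 whenever the point
-- (x , y+1) is not strictly above y = (n/m) x, i.e. m(y+1) ≤ n x;
-- otherwise step (1,0) ↦ 𝟘.  The path has m + n steps.

christoffelFrom : (m n fuel x y : ℕ) → List Bit
christoffelFrom m n zero x y = []
christoffelFrom m n (suc k) x y =
  if does (m * suc y ℕ.≤? n * x)
  then b1 ∷ christoffelFrom m n k x (suc y)
  else b0 ∷ christoffelFrom m n k (suc x) y

C : ℕ → ℕ → List Bit
C m n = christoffelFrom m n (m + n) 0 0

_^_ : List Bit → ℕ → List Bit
w ^ p = concat (replicate p w)

-- φ : 𝟙 ↦ 𝟚, even-numbered occurrences of 𝟘 ↦ 𝟙, odd-numbered 𝟘 ↦ 𝟘.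
-- The Bool records whether an odd number of 𝟘's has been read so far.

φ-from : Bool → List Bit → List Letter
φ-from b [] = []
φ-from b (b1 ∷ w) = t2 ∷ φ-from b w
φ-from false (b0 ∷ w) = t0 ∷ φ-from true w
φ-from true (b0 ∷ w) = t1 ∷ φ-from false w

φ : List Bit → List Letter
φ = φ-from false

data Step : Set where
  ξ η ζ : Step

Point : Set
Point = ℕ × ℕ × ℕ

move : Step → Point → Point
move ξ (x , y , z) = (suc x , y , z)
move η (x , y , z) = (x , suc y , z)
move ζ (x , y , z) = (x , y , suc z)

endpoint : Point → List Step → Point
endpoint p [] = p
endpoint p (s ∷ ss) = endpoint (move s p) ss

γ-step : Letter → Step
γ-step t0 = ξ
γ-step t1 = η
γ-step t2 = ζ

γ : List Letter → List Step
γ [] = []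
γ (a ∷ w) = γ-step a ∷ γ w

ℕ→ℚ : ℕ → ℚ
ℕ→ℚ k = (+ k) ℚ./ 1

plane : ℚ → ℚ → ℕ → ℕ → ℚ
plane q₁ q₂ x y = q₁ ℚ.* ℕ→ℚ x ℚ.+ q₂ ℚ.* ℕ→ℚ y

-- The step prescribed by the construction at point (x,y,z); the Bool
-- says whether the next of the alternating steps ξ, η is ξ.
nextStep : ℚ → ℚ → Bool → Point → Step
nextStep q₁ q₂ useξ (x , y , z) =
  if does (ℕ→ℚ (suc z) ℚP.≤? plane q₁ q₂ x y)
  then ζ
  else (if useξ then ξ else η)

flipAfter : Step → Bool → Bool
flipAfter ξ b = false
flipAfter η b = true
flipAfter ζ b = b

Follows : ℚ → ℚ → Bool → Point → List Step → Set
Follows q₁ q₂ b p [] = ⊤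
Follows q₁ q₂ b p (s ∷ ss) =
  (s ≡ nextStep q₁ q₂ b p) × Follows q₁ q₂ (flipAfter s b) (move s p) ss

Terminal : ℚ → ℚ → Point → Set
Terminal q₁ q₂ (x , y , z) = (x ≡ y) × (ℕ→ℚ z ≡ plane q₁ q₂ x y)

NonEmpty : List Step → Set
NonEmpty [] = ⊥
NonEmpty (_ ∷ _) = ⊤

origin : Point
origin = (0 , 0 , 0)

DiscreteApprox : ℚ → ℚ → List Step → Set
DiscreteApprox q₁ q₂ path =
  NonEmpty path × Follows q₁ q₂ true origin path
  × Terminal q₁ q₂ (endpoint origin path)

module Submission where

-- For q = n/m the plane test of the construction at (x, y, z), z + 1 ≤ q (x + y), is exactly
-- the test of the Christoffel construction at the planar point (x + y, z). Hence the projection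
-- (x, y, z) ↦ (x + y, z) of the discrete approximation is the Christoffel path of slope n/m,
-- continued periodically, and the alternation of ξ and η is the alternation 𝟘 ↦ 𝟘, 𝟙 performed
-- by φ: every initial segment of the approximation is γ(φ(w)) for an initial segment w of
-- C(m, n)^∞. The admissible termination points are the points (x, x, z) with m z = 2 n x; by
-- coprimality they are reached exactly after p whole periods, where p m = 2 x is even.

open import Defs
open import Data.Nat using (ℕ; _*_; _≤_; NonZero)
open import Data.Nat.Divisibility using (_∣_)
open import Data.Nat.Coprimality using (Coprime)
open import Data.Integer using (+_)
open import Data.Rational using (_/_)
open import Data.List using (List)
open import Data.List.Membership.Propositional using (_∈_)
open import Data.Product using (_×_; ∃-syntax)
open import Relation.Binary.PropositionalEquality using (_≡_)
open import Function.Bundles using (_⇔_)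

open import Data.Nat using (zero; suc; _+_; _<_; _≤?_; z≤n; s≤s; >-nonZero⁻¹)
import Data.Nat.Properties as ℕP
open import Data.Nat.Divisibility using (divides; ∣m+n∣m⇒∣n; ∣1⇒≡1)
open import Data.Nat.Coprimality using (coprime-divisor)
open import Data.Nat.Tactic.RingSolver using (solve-∀)
import Data.Integer as ℤ
import Data.Integer.Properties as ℤP
open import Data.Rational as ℚ using (ℚ; toℚᵘ)
import Data.Rational.Properties as ℚP
open import Data.Rational.Unnormalised as ℚᵘ using (*≡*; *≤*)
  renaming (_/_ to _/ᵘ_; _≃_ to _≃ᵘ_; _≤_ to _≤ᵘ_)
import Data.Rational.Unnormalised.Properties as ℚᵘP
import Data.Integer.Tactic.RingSolver as ℤ-Solver
open import Data.Bool using (Bool; true; false; not; if_then_else_)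
open import Data.List using ([]; _∷_; _++_; length; map)
open import Data.List.Relation.Unary.Any using (here; there)
open import Data.Product using (_,_; proj₁; proj₂; Σ; uncurry)
import Data.Product as Product
open import Data.Product.Properties using (,-injectiveˡ; ,-injectiveʳ)
open import Data.Empty using (⊥-elim)
open import Data.Unit using (tt)
open import Function using (_∘_; id)
open import Function.Construct.Composition using (_⇔-∘_)
open import Function.Bundles using (mk⇔; Equivalence)
open import Relation.Binary.PropositionalEquality using (refl; sym; trans; cong; cong₂; subst; subst₂; module ≡-Reasoning)
open import Relation.Nullary using (does; proof; ofʸ; ofⁿ; ¬_; contradiction)
open import Relation.Nullary.Decidable using (does-⇔)

toℚᵘ-/ : ∀ i d .{{_ : NonZero d}} → toℚᵘ (i / d) ≃ᵘ i /ᵘ d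
toℚᵘ-/ i (suc d) = ℚP.toℚᵘ-fromℚᵘ (i /ᵘ suc d)

/ᵘ-≤-/ᵘ : ∀ a b c d .{{_ : NonZero c}} .{{_ : NonZero d}} →
          (+ a /ᵘ c ≤ᵘ + b /ᵘ d) ⇔ (a * d ≤ b * c)
/ᵘ-≤-/ᵘ a b (suc c) (suc d) = mk⇔
  (λ { (*≤* le) → ℤP.drop‿+≤+ (subst₂ ℤ._≤_ (sym (ℤP.pos-* a (suc d))) (sym (ℤP.pos-* b (suc c))) le) })
  (λ le → *≤* (subst₂ ℤ._≤_ (ℤP.pos-* a (suc d)) (ℤP.pos-* b (suc c)) (ℤ.+≤+ le)))

/ᵘ-≃-/ᵘ : ∀ a b c d .{{_ : NonZero c}} .{{_ : NonZero d}} →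
          (+ a /ᵘ c ≃ᵘ + b /ᵘ d) ⇔ (a * d ≡ b * c)
/ᵘ-≃-/ᵘ a b (suc c) (suc d) = mk⇔
  (λ { (*≡* e) → ℤP.+-injective (trans (ℤP.pos-* a (suc d)) (trans e (sym (ℤP.pos-* b (suc c))))) })
  (λ e → *≡* (trans (sym (ℤP.pos-* a (suc d))) (trans (cong +_ e) (ℤP.pos-* b (suc c)))))

/ᵘ-distrib-+ : ∀ n x y d .{{_ : NonZero d}} →
  (+ n /ᵘ d) ℚᵘ.* (+ x /ᵘ 1) ℚᵘ.+ (+ n /ᵘ d) ℚᵘ.* (+ y /ᵘ 1) ≃ᵘ + (n * (x + y)) /ᵘ d
/ᵘ-distrib-+ n x y (suc d) rewrite ℕP.*-identityʳ d | ℤP.pos-* n (x + y) | ℤP.pos-+ x y =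
  *≡* (identity (+ n) (+ x) (+ y) (+ suc d))
  where
  identity : ∀ n x y d → (n ℤ.* x ℤ.* d ℤ.+ n ℤ.* y ℤ.* d) ℤ.* d ≡ n ℤ.* (x ℤ.+ y) ℤ.* (d ℤ.* d)
  identity = ℤ-Solver.solve-∀

toℚᵘ-plane : ∀ n d x y .{{_ : NonZero d}} →
             toℚᵘ (plane (+ n / d) (+ n / d) x y) ≃ᵘ + (n * (x + y)) /ᵘ d
toℚᵘ-plane n d x y = begin
  toℚᵘ (q ℚ.* ℕ→ℚ x ℚ.+ q ℚ.* ℕ→ℚ y)
    ≈⟨ ℚP.toℚᵘ-homo-+ (q ℚ.* ℕ→ℚ x) (q ℚ.* ℕ→ℚ y) ⟩
  toℚᵘ (q ℚ.* ℕ→ℚ x) ℚᵘ.+ toℚᵘ (q ℚ.* ℕ→ℚ y)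
    ≈⟨ ℚᵘP.+-cong (toℚᵘ-q* x) (toℚᵘ-q* y) ⟩
  (+ n /ᵘ d) ℚᵘ.* (+ x /ᵘ 1) ℚᵘ.+ (+ n /ᵘ d) ℚᵘ.* (+ y /ᵘ 1)
    ≈⟨ /ᵘ-distrib-+ n x y d ⟩
  + (n * (x + y)) /ᵘ d ∎
  where
  open ℚᵘP.≃-Reasoning
  q = + n / d
  toℚᵘ-q* : ∀ k → toℚᵘ (q ℚ.* ℕ→ℚ k) ≃ᵘ (+ n /ᵘ d) ℚᵘ.* (+ k /ᵘ 1)
  toℚᵘ-q* k = ℚᵘP.≃-trans (ℚP.toℚᵘ-homo-* q (ℕ→ℚ k)) (ℚᵘP.*-cong (toℚᵘ-/ (+ n) d) (toℚᵘ-/ (+ k) 1))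

toℚᵘ-≤⇔ : ∀ {p r p′ r′} → toℚᵘ p ≃ᵘ p′ → toℚᵘ r ≃ᵘ r′ → (p ℚ.≤ r) ⇔ (p′ ≤ᵘ r′)
toℚᵘ-≤⇔ p≃ r≃ = mk⇔
  (λ p≤r → ℚᵘP.≤-respʳ-≃ r≃ (ℚᵘP.≤-respˡ-≃ p≃ (ℚP.toℚᵘ-mono-≤ p≤r)))
  (λ p′≤r′ → ℚP.toℚᵘ-cancel-≤ (ℚᵘP.≤-respʳ-≃ (ℚᵘP.≃-sym r≃) (ℚᵘP.≤-respˡ-≃ (ℚᵘP.≃-sym p≃) p′≤r′)))

toℚᵘ-≡⇔ : ∀ {p r p′ r′} → toℚᵘ p ≃ᵘ p′ → toℚᵘ r ≃ᵘ r′ → (p ≡ r) ⇔ (p′ ≃ᵘ r′)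
toℚᵘ-≡⇔ p≃ r≃ = mk⇔
  (λ p≡r → ℚᵘP.≃-trans (ℚᵘP.≃-sym p≃) (ℚᵘP.≃-trans (ℚP.toℚᵘ-cong p≡r) r≃))
  (λ p′≃r′ → ℚP.toℚᵘ-injective (ℚᵘP.≃-trans p≃ (ℚᵘP.≃-trans p′≃r′ (ℚᵘP.≃-sym r≃))))

module _ (m n : ℕ) .{{_ : NonZero m}} (a x y : ℕ) where

  private
    q : ℚ
    q = + n / m

    normalise : ∀ {R : ℕ → ℕ → Set} → R (a * m) (n * (x + y) * 1) ⇔ R (m * a) (n * (x + y))
    normalise rewrite ℕP.*-comm a m | ℕP.*-identityʳ (n * (x + y)) = mk⇔ id id

  ℕ→ℚ≤plane⇔ : (ℕ→ℚ a ℚ.≤ plane q q x y) ⇔ (m * a ≤ n * (x + y))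
  ℕ→ℚ≤plane⇔ =
    normalise {_≤_} ⇔-∘ (/ᵘ-≤-/ᵘ a (n * (x + y)) 1 m ⇔-∘ toℚᵘ-≤⇔ (toℚᵘ-/ (+ a) 1) (toℚᵘ-plane n m x y))

  ℕ→ℚ≡plane⇔ : (ℕ→ℚ a ≡ plane q q x y) ⇔ (m * a ≡ n * (x + y))
  ℕ→ℚ≡plane⇔ =
    normalise {_≡_} ⇔-∘ (/ᵘ-≃-/ᵘ a (n * (x + y)) 1 m ⇔-∘ toℚᵘ-≡⇔ (toℚᵘ-/ (+ a) 1) (toℚᵘ-plane n m x y))

module _ (m n : ℕ) where

  christoffelEnd : (fuel x y : ℕ) → ℕ × ℕ
  christoffelEnd zero x y = x , y
  christoffelEnd (suc k) x y =
    if does (m * suc y ≤? n * x) then christoffelEnd k x (suc y) else christoffelEnd k (suc x) y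

  christoffelFrom-+ : ∀ k l x y → christoffelFrom m n (k + l) x y ≡
                      christoffelFrom m n k x y ++ uncurry (christoffelFrom m n l) (christoffelEnd k x y)
  christoffelFrom-+ zero l x y = refl
  christoffelFrom-+ (suc k) l x y with does (m * suc y ≤? n * x)
  ... | true  = cong (b1 ∷_) (christoffelFrom-+ k l x (suc y))
  ... | false = cong (b0 ∷_) (christoffelFrom-+ k l (suc x) y)

  christoffelEnd-+ : ∀ k l x y → christoffelEnd (k + l) x y ≡ uncurry (christoffelEnd l) (christoffelEnd k x y)
  christoffelEnd-+ zero l x y = refl
  christoffelEnd-+ (suc k) l x y with does (m * suc y ≤? n * x)
  ... | true  = christoffelEnd-+ k l x (suc y)
  ... | false = christoffelEnd-+ k l (suc x) y

  christoffelEnd-sum : ∀ k x y → uncurry _+_ (christoffelEnd k x y) ≡ x + y + k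
  christoffelEnd-sum zero x y = sym (ℕP.+-identityʳ (x + y))
  christoffelEnd-sum (suc k) x y with does (m * suc y ≤? n * x)
  ... | true  = trans (christoffelEnd-sum k x (suc y))
                      (trans (cong (_+ k) (ℕP.+-suc x y)) (sym (ℕP.+-suc (x + y) k)))
  ... | false = trans (christoffelEnd-sum k (suc x) y) (sym (ℕP.+-suc (x + y) k))

  step-shift : ∀ x y → (m * suc (y + n) ≤ n * (x + m)) ⇔ (m * suc y ≤ n * x)
  step-shift x y rewrite ℕP.*-distribˡ-+ m (suc y) n | ℕP.*-distribˡ-+ n x m | ℕP.*-comm n m =
    mk⇔ (ℕP.+-cancelʳ-≤ (m * n) (m * suc y) (n * x)) (ℕP.+-monoˡ-≤ (m * n))

  christoffelFrom-shift : ∀ k x y → christoffelFrom m n k (x + m) (y + n) ≡ christoffelFrom m n k x y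
  christoffelFrom-shift zero x y = refl
  christoffelFrom-shift (suc k) x y
    rewrite does-⇔ (step-shift x y) (m * suc (y + n) ≤? n * (x + m)) (m * suc y ≤? n * x)
    with does (m * suc y ≤? n * x)
  ... | true  = cong (b1 ∷_) (christoffelFrom-shift k x (suc y))
  ... | false = cong (b0 ∷_) (christoffelFrom-shift k (suc x) y)

  christoffelEnd-shift : ∀ k x y →
                         christoffelEnd k (x + m) (y + n) ≡ Product.map (_+ m) (_+ n) (christoffelEnd k x y)
  christoffelEnd-shift zero x y = refl
  christoffelEnd-shift (suc k) x y
    rewrite does-⇔ (step-shift x y) (m * suc (y + n) ≤? n * (x + m)) (m * suc y ≤? n * x)
    with does (m * suc y ≤? n * x)
  ... | true  = christoffelEnd-shift k x (suc y)
  ... | false = christoffelEnd-shift k (suc x) y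

  -- (x, y) is not above the line y = (n/m) x, while (x − 1, y + 1) is above it.
  InStrip : ℕ × ℕ → Set
  InStrip (x , y) = m * y ≤ n * x × n * x < m * suc y + n

  christoffelEnd-inStrip : ∀ k x y → InStrip (x , y) → InStrip (christoffelEnd k x y)
  christoffelEnd-inStrip zero x y strip = strip
  christoffelEnd-inStrip (suc k) x y (below , near)
    with does (m * suc y ≤? n * x) | proof (m * suc y ≤? n * x)
  ... | true  | ofʸ up = christoffelEnd-inStrip k x (suc y)
         (up , ℕP.<-≤-trans near (ℕP.+-monoˡ-≤ n (ℕP.*-monoʳ-≤ m (ℕP.n≤1+n (suc y)))))
  ... | false | ofⁿ ¬up = christoffelEnd-inStrip k (suc x) y
         (ℕP.≤-trans below (ℕP.*-monoʳ-≤ n (ℕP.n≤1+n x)) ,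
          subst₂ _<_ (sym (ℕP.*-suc n x)) (ℕP.+-comm n (m * suc y)) (ℕP.+-monoʳ-< n (ℕP.≰⇒> ¬up)))

  inStrip-level : .{{_ : NonZero m}} → ∀ {x y} → InStrip (x , y) → x + y ≡ m + n → y ≡ n
  inStrip-level {x} {y} (below , near) level = ℕP.≤-antisym (ℕP.≮⇒≥ n≮y) (ℕP.≮⇒≥ y≮n)
    where
    open ℕP.≤-Reasoning
    y≮n : ¬ y < n
    y≮n y<n = ℕP.<-irrefl refl (begin-strict
      n * suc m      ≤⟨ ℕP.*-monoʳ-≤ n m<x ⟩
      n * x          <⟨ near ⟩
      m * suc y + n  ≤⟨ ℕP.+-monoˡ-≤ n (ℕP.*-monoʳ-≤ m y<n) ⟩
      m * n + n      ≡⟨ reorder m n ⟩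
      n * suc m      ∎)
      where
      m<x : m < x
      m<x = ℕP.≰⇒> (λ x≤m → ℕP.<-irrefl level (ℕP.+-mono-≤-< x≤m y<n))
      reorder : ∀ m n → m * n + n ≡ n * suc m
      reorder = solve-∀
    n≮y : ¬ n < y
    n≮y n<y = ℕP.<-irrefl refl (begin-strict
      m * n          <⟨ ℕP.*-monoʳ-< m (ℕP.n<1+n n) ⟩
      m * suc n      ≤⟨ ℕP.*-monoʳ-≤ m n<y ⟩
      m * y          ≤⟨ below ⟩
      n * x          ≤⟨ ℕP.*-monoʳ-≤ n (ℕP.<⇒≤ x<m) ⟩
      n * m          ≡⟨ ℕP.*-comm n m ⟩
      m * n          ∎)
      where
      x<m : x < m
      x<m = ℕP.≰⇒> (λ m≤x → ℕP.<-irrefl (sym level) (ℕP.+-mono-≤-< m≤x n<y))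

  christoffelEnd-C : .{{_ : NonZero m}} → christoffelEnd (m + n) 0 0 ≡ (m , n)
  christoffelEnd-C = cong₂ _,_ (ℕP.+-cancelʳ-≡ n x m (subst (λ y′ → x + y′ ≡ m + n) y≡n sum)) y≡n
    where
    x = proj₁ (christoffelEnd (m + n) 0 0)
    y = proj₂ (christoffelEnd (m + n) 0 0)
    sum : x + y ≡ m + n
    sum = christoffelEnd-sum (m + n) 0 0
    origin-inStrip : InStrip (0 , 0)
    origin-inStrip rewrite ℕP.*-zeroʳ m | ℕP.*-zeroʳ n | ℕP.*-identityʳ m =
      z≤n , ℕP.<-≤-trans (>-nonZero⁻¹ m) (ℕP.m≤m+n m n)
    y≡n : y ≡ n
    y≡n = inStrip-level (christoffelEnd-inStrip (m + n) 0 0 origin-inStrip) sum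

  christoffelFrom-power : .{{_ : NonZero m}} → ∀ p → christoffelFrom m n (p * (m + n)) 0 0 ≡ C m n ^ p
  christoffelFrom-power zero    = refl
  christoffelFrom-power (suc p) = begin
    christoffelFrom m n (m + n + p * (m + n)) 0 0
      ≡⟨ christoffelFrom-+ (m + n) (p * (m + n)) 0 0 ⟩
    C m n ++ uncurry (christoffelFrom m n (p * (m + n))) (christoffelEnd (m + n) 0 0)
      ≡⟨ cong (λ e → C m n ++ uncurry (christoffelFrom m n (p * (m + n))) e) christoffelEnd-C ⟩
    C m n ++ christoffelFrom m n (p * (m + n)) (0 + m) (0 + n)
      ≡⟨ cong (C m n ++_) (trans (christoffelFrom-shift (p * (m + n)) 0 0) (christoffelFrom-power p)) ⟩
    C m n ^ suc p ∎
    where open ≡-Reasoning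

  christoffelEnd-power : .{{_ : NonZero m}} → ∀ p → christoffelEnd (p * (m + n)) 0 0 ≡ (p * m , p * n)
  christoffelEnd-power zero    = refl
  christoffelEnd-power (suc p) = begin
    christoffelEnd (m + n + p * (m + n)) 0 0
      ≡⟨ christoffelEnd-+ (m + n) (p * (m + n)) 0 0 ⟩
    uncurry (christoffelEnd (p * (m + n))) (christoffelEnd (m + n) 0 0)
      ≡⟨ cong (uncurry (christoffelEnd (p * (m + n)))) christoffelEnd-C ⟩
    christoffelEnd (p * (m + n)) (0 + m) (0 + n)
      ≡⟨ christoffelEnd-shift (p * (m + n)) 0 0 ⟩
    Product.map (_+ m) (_+ n) (christoffelEnd (p * (m + n)) 0 0)
      ≡⟨ cong (Product.map (_+ m) (_+ n)) (christoffelEnd-power p) ⟩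
    (p * m + m , p * n + n)
      ≡⟨ cong₂ _,_ (ℕP.+-comm (p * m) m) (ℕP.+-comm (p * n) n) ⟩
    (suc p * m , suc p * n) ∎
    where open ≡-Reasoning

Balanced : Bool → Point → Set
Balanced true  (x , y , _) = x ≡ y
Balanced false (x , y , _) = x ≡ suc y

module _ (q₁ q₂ : ℚ) where

  approximation : ℕ → Bool → Point → List Step
  approximation zero    b P = []
  approximation (suc k) b P = let s = nextStep q₁ q₂ b P in s ∷ approximation k (flipAfter s b) (move s P)

  approximation-follows : ∀ k b P → Follows q₁ q₂ b P (approximation k b P)
  approximation-follows zero    b P = tt
  approximation-follows (suc k) b P = refl , approximation-follows k _ _

  follows⇒≡approximation : ∀ {b P} ss → Follows q₁ q₂ b P ss → ss ≡ approximation (length ss) b P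
  follows⇒≡approximation []       _          = refl
  follows⇒≡approximation (s ∷ ss) (refl , f) = cong (s ∷_) (follows⇒≡approximation ss f)

  nextStep-balanced : ∀ {b P} → Balanced b P →
                      let s = nextStep q₁ q₂ b P in Balanced (flipAfter s b) (move s P)
  nextStep-balanced {true} {x , y , z} bal with does (ℕ→ℚ (suc z) ℚP.≤? plane q₁ q₂ x y)
  ... | true  = bal
  ... | false = cong suc bal
  nextStep-balanced {false} {x , y , z} bal with does (ℕ→ℚ (suc z) ℚP.≤? plane q₁ q₂ x y)
  ... | true  = bal
  ... | false = bal

  approximation-balanced : ∀ k {b P} → Balanced b P →
                           Σ Bool λ b′ → Balanced b′ (endpoint P (approximation k b P))
  approximation-balanced zero    {b} bal = b , bal
  approximation-balanced (suc k)     bal = approximation-balanced k (nextStep-balanced bal)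

letter : Step → Letter
letter ξ = t0
letter η = t1
letter ζ = t2

letter-γ : ∀ w → map letter (γ w) ≡ w
letter-γ []      = refl
letter-γ (t0 ∷ w) = cong (t0 ∷_) (letter-γ w)
letter-γ (t1 ∷ w) = cong (t1 ∷_) (letter-γ w)
letter-γ (t2 ∷ w) = cong (t2 ∷_) (letter-γ w)

γ-injective : ∀ {v w} → γ v ≡ γ w → v ≡ w
γ-injective {v} {w} γv≡γw = trans (sym (letter-γ v)) (trans (cong (map letter) γv≡γw) (letter-γ w))

∈⇒γ-nonEmpty : ∀ {a w} → a ∈ w → NonEmpty (γ w)
∈⇒γ-nonEmpty (here _)  = tt
∈⇒γ-nonEmpty (there _) = tt

2∣n+n : ∀ y → 2 ∣ y + y
2∣n+n y = divides y (double y)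
  where
  double : ∀ y → y + y ≡ y * 2
  double = solve-∀

2∤odd : ∀ y → ¬ 2 ∣ suc y + y
2∤odd y 2∣odd = contradiction (∣1⇒≡1 2∣1) λ ()
  where
  2∣1 : 2 ∣ 1
  2∣1 = ∣m+n∣m⇒∣n {m = y + y} (subst (2 ∣_) (ℕP.+-comm 1 (y + y)) 2∣odd) (2∣n+n y)

balanced-even⇒diagonal : ∀ b {x y z} → Balanced b (x , y , z) → 2 ∣ x + y → x ≡ y
balanced-even⇒diagonal true  x≡y    _    = x≡y
balanced-even⇒diagonal false {y = y} refl even = ⊥-elim (2∤odd y even)

flatten : Point → ℕ × ℕ
flatten (x , y , z) = x + y , z

module _ (m n : ℕ) .{{_ : NonZero m}} where

  private
    q : ℚ
    q = + n / m

  nextStep-christoffel : ∀ b x y z →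
    nextStep q q b (x , y , z) ≡ (if does (m * suc z ≤? n * (x + y)) then ζ else (if b then ξ else η))
  nextStep-christoffel b x y z = cong (λ up → if up then ζ else (if b then ξ else η))
    (does-⇔ (ℕ→ℚ≤plane⇔ m n (suc z) x y) (ℕ→ℚ (suc z) ℚP.≤? plane q q x y) (m * suc z ≤? n * (x + y)))

  -- φ-from records whether an odd number of 𝟘's has been read, i.e. whether η is the next
  -- horizontal step: the opposite of the flag of the construction.
  γφ-christoffelFrom : ∀ k b x y z →
    γ (φ-from (not b) (christoffelFrom m n k (x + y) z)) ≡ approximation q q k b (x , y , z)
  γφ-christoffelFrom zero b x y z = refl
  γφ-christoffelFrom (suc k) b x y z
    rewrite nextStep-christoffel b x y z with does (m * suc z ≤? n * (x + y))
  γφ-christoffelFrom (suc k) b     x y z | true  = cong (ζ ∷_) (γφ-christoffelFrom k b x y (suc z))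
  γφ-christoffelFrom (suc k) true  x y z | false = cong (ξ ∷_) (γφ-christoffelFrom k false (suc x) y z)
  γφ-christoffelFrom (suc k) false x y z | false = cong (η ∷_)
    (subst (λ u → γ (φ-from false (christoffelFrom m n k u z)) ≡ approximation q q k true (x , suc y , z))
           (ℕP.+-suc x y) (γφ-christoffelFrom k true x (suc y) z))

  flatten-endpoint : ∀ k b P →
    flatten (endpoint P (approximation q q k b P)) ≡ uncurry (christoffelEnd m n k) (flatten P)
  flatten-endpoint zero b P = refl
  flatten-endpoint (suc k) b (x , y , z)
    rewrite nextStep-christoffel b x y z with does (m * suc z ≤? n * (x + y))
  flatten-endpoint (suc k) b     (x , y , z) | true  = flatten-endpoint k b (x , y , suc z)
  flatten-endpoint (suc k) true  (x , y , z) | false = flatten-endpoint k false (suc x , y , z)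
  flatten-endpoint (suc k) false (x , y , z) | false =
    trans (flatten-endpoint k true (x , suc y , z)) (cong (λ u → christoffelEnd m n k u z) (ℕP.+-suc x y))

  γφ-power : ∀ p → γ (φ (C m n ^ p)) ≡ approximation q q (p * (m + n)) true origin
  γφ-power p =
    trans (cong (γ ∘ φ) (sym (christoffelFrom-power m n p))) (γφ-christoffelFrom (p * (m + n)) true 0 0 0)

  terminal-of-power : ∀ p {b P} → 2 ∣ p * m → Balanced b P → flatten P ≡ (p * m , p * n) → Terminal q q P
  terminal-of-power p {b} {x , y , z} even bal flat =
    x≡y , Equivalence.from (ℕ→ℚ≡plane⇔ m n z x y) (begin
      m * z       ≡⟨ cong (m *_) (,-injectiveʳ flat) ⟩
      m * (p * n) ≡⟨ swap m n p ⟩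
      n * (p * m) ≡⟨ cong (n *_) (sym (,-injectiveˡ flat)) ⟩
      n * (x + y) ∎)
    where
    open ≡-Reasoning
    x≡y : x ≡ y
    x≡y = balanced-even⇒diagonal b bal (subst (2 ∣_) (sym (,-injectiveˡ flat)) even)
    swap : ∀ m n p → m * (p * n) ≡ n * (p * m)
    swap = solve-∀

  christoffel-power-approximates : ∀ p → 2 ∣ p * m → NonEmpty (γ (φ (C m n ^ p))) →
                                   DiscreteApprox q q (γ (φ (C m n ^ p)))
  christoffel-power-approximates p even nonEmpty = subst (DiscreteApprox q q) (sym (γφ-power p))
    ( subst NonEmpty (γφ-power p) nonEmpty
    , approximation-follows q q k true origin
    , terminal-of-power p even (proj₂ balanced)
        (trans (flatten-endpoint k true origin) (christoffelEnd-power m n p)))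
    where
    k = p * (m + n)
    balanced = approximation-balanced q q k {true} {origin} refl

  terminal⇒period : Coprime m n → ∀ {P} → Terminal q q P → ∃[ p ] (flatten P ≡ (p * m , p * n) × 2 ∣ p * m)
  terminal⇒period coprime {x , y , z} (x≡y , onPlane) =
    period (coprime-divisor coprime (divides z (trans (sym mz≡) (ℕP.*-comm m z))))
    where
    mz≡ : m * z ≡ n * (x + y)
    mz≡ = Equivalence.to (ℕ→ℚ≡plane⇔ m n z x y) onPlane
    swap : ∀ m n p → n * (p * m) ≡ m * (p * n)
    swap = solve-∀
    period : m ∣ x + y → ∃[ p ] (flatten (x , y , z) ≡ (p * m , p * n) × 2 ∣ p * m)
    period (divides p x+y≡pm) =
      p , cong₂ _,_ x+y≡pm z≡pn , subst (2 ∣_) x+y≡pm (subst (λ x′ → 2 ∣ x′ + y) (sym x≡y) (2∣n+n y))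
      where
      open ≡-Reasoning
      z≡pn : z ≡ p * n
      z≡pn = ℕP.*-cancelˡ-≡ z (p * n) m (begin
        m * z       ≡⟨ mz≡ ⟩
        n * (x + y) ≡⟨ cong (n *_) x+y≡pm ⟩
        n * (p * m) ≡⟨ swap m n p ⟩
        m * (p * n) ∎)

  approximation⇒christoffel-power : Coprime m n → ∀ w → DiscreteApprox q q (γ w) →
                                    ∃[ p ] (1 ≤ p × 2 ∣ p * m × w ≡ φ (C m n ^ p))
  approximation⇒christoffel-power coprime w (nonEmpty , follows , terminal) =
    p , positive p (subst NonEmpty γw≡power nonEmpty) , even , γ-injective (trans γw≡power (sym (γφ-power p)))
    where
    ℓ = length (γ w)
    γw≡ : γ w ≡ approximation q q ℓ true origin
    γw≡ = follows⇒≡approximation q q (γ w) follows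
    period = terminal⇒period coprime (subst (Terminal q q ∘ endpoint origin) γw≡ terminal)
    p = proj₁ period
    flat = proj₁ (proj₂ period)
    even = proj₂ (proj₂ period)
    ℓ≡ : ℓ ≡ p * (m + n)
    ℓ≡ = begin
      ℓ
        ≡⟨ christoffelEnd-sum m n ℓ 0 0 ⟨
      uncurry _+_ (christoffelEnd m n ℓ 0 0)
        ≡⟨ cong (uncurry _+_) (flatten-endpoint ℓ true origin) ⟨
      uncurry _+_ (flatten (endpoint origin (approximation q q ℓ true origin)))
        ≡⟨ cong (uncurry _+_) flat ⟩
      p * m + p * n
        ≡⟨ ℕP.*-distribˡ-+ p m n ⟨
      p * (m + n) ∎
      where open ≡-Reasoning
    γw≡power : γ w ≡ approximation q q (p * (m + n)) true origin
    γw≡power = trans γw≡ (cong (λ k → approximation q q k true origin) ℓ≡)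
    positive : ∀ p → NonEmpty (approximation q q (p * (m + n)) true origin) → 1 ≤ p
    positive zero    ()
    positive (suc _) _ = s≤s z≤n

theorem3 : (m n : ℕ) .{{_ : NonZero m}} .{{_ : NonZero n}} → Coprime m n →
           (w : List Letter) → t0 ∈ w → t1 ∈ w → t2 ∈ w →
           (∃[ p ] (1 ≤ p × 2 ∣ p * m × w ≡ φ (C m n ^ p)))
             ⇔ DiscreteApprox ((+ n) / m) ((+ n) / m) (γ w)
-- Nonemptiness of γ w is taken from t0 ∈ w.
theorem3 m n coprime w t0∈w _ _ = mk⇔
  (λ { (p , _ , even , w≡) → subst (DiscreteApprox _ _ ∘ γ) (sym w≡)
         (christoffel-power-approximates m n p even (∈⇒γ-nonEmpty (subst (t0 ∈_) w≡ t0∈w))) })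
  (approximation⇒christoffel-power m n coprime w)
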